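{- Let $\mathsf{CS}$ be an axiomatically appropriate and schematic constant specification for $\mathsf{JEM}$. There exists a normal realization $r$ such that for every modal formula $A$: if $\mathsf{GM}\vdash\ \supset A$, then $\mathsf{JEM}_{\mathsf{CS}}\vdash r(A)$.
   Context: Justification language. Fix countably many proof constants $\alpha_i$, proof variables $\xi_i$, justification variables $x_i$, and a countable set $\mathsf{Prop}$ of atomic propositions. Proof terms: $\lambda ::= \alpha_i \mid \xi_i \mid (\lambda\cdot\lambda) \mid\ !\lambda$. Justification terms: $t ::= x_i \mid t+t \mid \mathsf{m}(\lambda,t)$. Formulas: $F ::= P\mid\bot\mid(F\to F)\mid\lambda:F\mid[t]F$; other connectives are classical abbreviations. Axioms of $\mathsf{JEM}$: all instances of classical propositional tautologies and of (j) $\lambda:(F\to G)\to(\kappa:F\to\lambda\cdot\kappa:G)$; (jt) $\lambda:F\to F$; (j4) $\lambda:F\to\ !\lambda:\lambda:F$; (jm) $\lambda:(F\to G)\to([t]F\to[\mathsf{m}(\lambda,t)]G)$; (j+$_2$) $([t]F\vee[s]F)\to[t+s]F$. A constant specification $\mathsf{CS}$ is a set of pairs $(\alpha,A)$, $\alpha$ a proof constant, $A$ an axiom of $\mathsf{JEM}$; it is axiomatically appropriate if every axiom has some constant $\alpha$ with $(\alpha,A)\in\mathsf{CS}$, and schematic if for each constant $c$ the set $\{A\mid(c,A)\in\mathsf{CS}\}$ consists of all instances of one or several (possibly zero) axiom schemes of $\mathsf{JEM}$. $\mathsf{JEM}_{\mathsf{CS}}$ is the Hilbert system with these axioms, modus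 ponens, and axiom necessitation (infer $\alpha:A$ whenever $(\alpha,A)\in\mathsf{CS}$). Modal language: $A ::= P\mid\bot\mid(A\to A)\mid\Box A$. The sequent calculus $\mathsf{GM}$ works with sequents $\Gamma\supset\Delta$ ($\Gamma,\Delta$ finite multisets) and has: axioms $P\supset P$ and $\bot\supset$; rules $(\to\supset)$: from $\Gamma\supset\Delta,A$ and $B,\Gamma\supset\Delta$ infer $A\to B,\Gamma\supset\Delta$; $(\supset\to)$: from $A,\Gamma\supset\Delta,B$ infer $\Gamma\supset\Delta,A\to B$; weakening and contraction on both sides; and (RM): from $A\supset B$ infer $\Box A\supset\Box B$. Realization. Let $\mathsf{Fm}^{\mathsf J}$ be the justification formulas with no subformula of the form $\lambda:F$. The forgetful translation is $\bot^\circ=\bot$, $P^\circ=P$, $(A\to B)^\circ=A^\circ\to B^\circ$, $([t]A)^\circ=\Box A^\circ$. A realization is a map $r$ from modal formulas to $\mathsf{Fm}^{\mathsf J}$ with $(r(A))^\circ=A$. Polarity of subformula occurrences in a formula $A$: $A$ itself is positive; if $B\to C$ has some polarity then $C$ has the same and $B$ the opposite polarity; if $\Box B$ has some polarity then $B$ has the same. An occurrence of $\Box$ is negative (positive) if the subformula occurrence $\Box B$ it heads is negative (positive). A realization $r$ is normal if, for each $A$, in $r(A)$ all negative occurrences of $\Box$ of $A$ are realized by (i.e. replaced by $[x]$ with) justification variables, distinct occurrences receiving distinct variables. -}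

module Defs where

open import Data.Nat using (ℕ)
open import Data.Bool using (Bool; true; false; not; if_then_else_)
open import Data.List using (List; []; _∷_; _++_; map)
open import Data.List.Relation.Unary.Unique.Propositional using (Unique)
open import Data.List.Relation.Binary.Permutation.Propositional using (_↭_)
open import Data.Product using (Σ; ∃; _×_; _,_)
open import Relation.Binary.PropositionalEquality using (_≡_)
open import Function.Bundles using (_⇔_)

data PTerm : Set where
  pconst : ℕ → PTerm
  pvar   : ℕ → PTerm
  _·_    : PTerm → PTerm → PTerm
  !_     : PTerm → PTerm

data JTerm : Set where
  jvar : ℕ → JTerm
  _⊕_  : JTerm → JTerm → JTerm
  jm   : PTerm → JTerm → JTerm

data Form : Set where
  atom : ℕ → Form
  fbot : Form
  _⇒_  : Form → Form → Form
  _∶_  : PTerm → Form → Form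
  [_]_ : JTerm → Form → Form

infixr 5 _⇒_

_∨_ : Form → Form → Form
F ∨ G = (F ⇒ fbot) ⇒ G

data PForm : Set where
  pv   : ℕ → PForm
  pbot : PForm
  _p⇒_ : PForm → PForm → PForm

evalP : (ℕ → Bool) → PForm → Bool
evalP v (pv n) = v n
evalP v pbot = false
evalP v (φ p⇒ ψ) = if evalP v φ then evalP v ψ else true

Tautology : PForm → Set
Tautology φ = ∀ (v : ℕ → Bool) → evalP v φ ≡ true

substP : (ℕ → Form) → PForm → Form
substP σ (pv n) = σ n
substP σ pbot = fbot
substP σ (φ p⇒ ψ) = substP σ φ ⇒ substP σ ψ

data Scheme : Set where
  taut : (φ : PForm) → Tautology φ → Scheme
  ax-j ax-jt ax-j4 ax-jm ax-j+ : Scheme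

Instance : Scheme → Form → Set
Instance (taut φ _) A = ∃ λ (σ : ℕ → Form) → substP σ φ ≡ A
Instance ax-j A = Σ PTerm λ l → Σ PTerm λ k → Σ Form λ F → Σ Form λ G →
  A ≡ ((l ∶ (F ⇒ G)) ⇒ ((k ∶ F) ⇒ ((l · k) ∶ G)))
Instance ax-jt A = Σ PTerm λ l → Σ Form λ F → A ≡ ((l ∶ F) ⇒ F)
Instance ax-j4 A = Σ PTerm λ l → Σ Form λ F → A ≡ ((l ∶ F) ⇒ ((! l) ∶ (l ∶ F)))
Instance ax-jm A = Σ PTerm λ l → Σ JTerm λ t → Σ Form λ F → Σ Form λ G →
  A ≡ ((l ∶ (F ⇒ G)) ⇒ (([ t ] F) ⇒ ([ jm l t ] G)))
Instance ax-j+ A = Σ JTerm λ t → Σ JTerm λ s → Σ Form λ F →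
  A ≡ ((([ t ] F) ∨ ([ s ] F)) ⇒ ([ t ⊕ s ] F))

Axiom : Form → Set
Axiom A = Σ Scheme λ s → Instance s A

-- Constant specifications: CS c A  means  (α_c , A) ∈ CS

ConstSpec : Set₁
ConstSpec = ℕ → Form → Set

IsConstSpec : ConstSpec → Set
IsConstSpec CS = ∀ c A → CS c A → Axiom A

AxiomaticallyAppropriate : ConstSpec → Set
AxiomaticallyAppropriate CS = ∀ A → Axiom A → ∃ λ c → CS c A

Schematic : ConstSpec → Set₁
Schematic CS = ∀ c → Σ (Scheme → Set) λ S →
  ∀ A → CS c A ⇔ (Σ Scheme λ s → S s × Instance s A)

data JEM⊢ (CS : ConstSpec) : Form → Set where
  ax  : ∀ {A} → Axiom A → JEM⊢ CS A
  mp  : ∀ {A B} → JEM⊢ CS (A ⇒ B) → JEM⊢ CS A → JEM⊢ CS B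
  nec : ∀ {c A} → CS c A → JEM⊢ CS (pconst c ∶ A)

data MForm : Set where
  matom : ℕ → MForm
  mbot  : MForm
  _m⇒_  : MForm → MForm → MForm
  □_    : MForm → MForm

-- sequents Γ ⊃ Δ with multisets represented by lists up to permutation
data GM : List MForm → List MForm → Set where
  axP   : ∀ P → GM (matom P ∷ []) (matom P ∷ [])
  ax⊥   : GM (mbot ∷ []) []
  perm  : ∀ {Γ Γ' Δ Δ'} → Γ ↭ Γ' → Δ ↭ Δ' → GM Γ Δ → GM Γ' Δ'
  ⇒⊃    : ∀ {Γ Δ A B} → GM Γ (A ∷ Δ) → GM (B ∷ Γ) Δ → GM ((A m⇒ B) ∷ Γ) Δ
  ⊃⇒    : ∀ {Γ Δ A B} → GM (A ∷ Γ) (B ∷ Δ) → GM Γ ((A m⇒ B) ∷ Δ)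
  wL    : ∀ {Γ Δ A} → GM Γ Δ → GM (A ∷ Γ) Δ
  wR    : ∀ {Γ Δ A} → GM Γ Δ → GM Γ (A ∷ Δ)
  cL    : ∀ {Γ Δ A} → GM (A ∷ A ∷ Γ) Δ → GM (A ∷ Γ) Δ
  cR    : ∀ {Γ Δ A} → GM Γ (A ∷ A ∷ Δ) → GM Γ (A ∷ Δ)
  RM    : ∀ {A B} → GM (A ∷ []) (B ∷ []) → GM ((□ A) ∷ []) ((□ B) ∷ [])

-- Forget F A :  F ∈ Fm^J (no subformula λ:G)  and  F° = A
data Forget : Form → MForm → Set where
  f-atom : ∀ P → Forget (atom P) (matom P)
  f-bot  : Forget fbot mbot
  f-imp  : ∀ {F G A B} → Forget F A → Forget G B → Forget (F ⇒ G) (A m⇒ B)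
  f-box  : ∀ {t F A} → Forget F A → Forget ([ t ] F) (□ A)

Realization : (MForm → Form) → Set
Realization r = ∀ A → Forget (r A) A

-- justification terms at the negative [t]-occurrences of a formula,
-- listed left to right; the Bool is the polarity (true = positive)
negTerms : Bool → Form → List JTerm
negTerms p (atom _) = []
negTerms p fbot = []
negTerms p (F ⇒ G) = negTerms (not p) F ++ negTerms p G
negTerms p (l ∶ F) = negTerms p F
negTerms p ([ t ] F) = (if p then [] else (t ∷ [])) ++ negTerms p F

-- in r(A) all negative □-occurrences are realized by justification
-- variables, distinct occurrences receiving distinct variables
Normal : (MForm → Form) → Set
Normal r = ∀ A → Σ (List ℕ) λ xs → map jvar xs ≡ negTerms true (r A) × Unique xs

-- Mark every □ of A with its polarity and give the negative ones distinct indices i; they are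
-- realized by the variables x_i. A GM-proof of A yields a proof in a set-based calculus on marked
-- formulas whose RM steps pair a negative [x_i]B with a positive □C. Each positive □C is realized
-- by the sum, over the negative boxes [x_i]B of A with B ⊃ C derivable, of m(λ, x_i), where λ
-- internalizes the (inductively realized) implication B → C; then (jm) and (j+) validate every RM
-- step and all other rules are propositional. For this sum to be computable, derivability of
-- marked sequents is decided: a sequent is derivable iff every assignment of its disjunctive normal
-- form is closed by an axiom or by a derivable RM step of smaller depth.
module Submission where

open import Defs

open import Data.Bool using (Bool; true; false; not; if_then_else_)
import Data.Bool.Properties as Bool
open import Data.Empty using (⊥; ⊥-elim)
open import Data.List using (List; []; _∷_; _++_; map; applyUpTo; upTo; cartesianProductWith)
open import Data.List.Membership.Propositional using (_∈_; find; lose)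
open import Data.List.Membership.Propositional.Properties using (∈-++⁺ˡ; ∈-++⁺ʳ; ∈-++⁻; ∈-map⁻; ∈-cartesianProductWith⁺; ∈-cartesianProductWith⁻)
open import Data.List.Properties using (map-++)
open import Data.List.Relation.Binary.Permutation.Propositional using (↭-trans)
open import Data.List.Relation.Binary.Permutation.Propositional.Properties using (shifts; ++-assoc)
open import Data.List.Relation.Binary.Subset.Propositional using (_⊆_)
open import Data.List.Relation.Binary.Subset.Propositional.Properties using (⊆-refl; ⊆-trans; ⊆-reflexive-↭; xs⊆x∷xs; xs⊆xs++ys; xs⊆ys++xs; ∷⁺ʳ; ∈-∷⁺ʳ; ++⁺ʳ)
open import Data.List.Relation.Unary.All as All using (All; []; _∷_)
import Data.List.Relation.Unary.All.Properties as All
open import Data.List.Relation.Unary.Any.Properties using (singleton⁻)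
open import Data.List.Relation.Unary.Any as Any using (Any; here; there)
open import Data.List.Relation.Unary.Unique.Propositional.Properties using (upTo⁺)
open import Data.Nat as ℕ using (ℕ; zero; suc; _+_; _⊔_; _≤_; s≤s⁻¹)
open import Data.Nat.Properties using (≤-refl; m⊔n≤o⇒m≤o; m⊔n≤o⇒n≤o; m≤m⊔n; m≤n⊔m)
open import Data.Product using (Σ; _×_; _,_; proj₁; proj₂; uncurry)
open import Data.Product.Properties using (≡-dec)
open import Data.Sum using (_⊎_; inj₁; inj₂)
open import Data.Unit using (⊤; tt)
open import Function using (id; _∘_)
open import Relation.Binary.Definitions using (DecidableEquality)
open import Relation.Binary.PropositionalEquality using (_≡_; refl; sym; trans; cong; cong₂; subst)
open import Relation.Nullary using (Dec; yes; no)
open import Relation.Nullary.Decidable using (map′; _×-dec_; _⊎-dec_; _→-dec_)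

private
  variable
    F G H : Form
    l : PTerm
    t s : JTerm
    CS : ConstSpec

_≟ᵖ_ : DecidableEquality PTerm
pconst m ≟ᵖ pconst n = map′ (cong pconst) (λ { refl → refl }) (m ℕ.≟ n)
pvar m ≟ᵖ pvar n = map′ (cong pvar) (λ { refl → refl }) (m ℕ.≟ n)
(a · b) ≟ᵖ (c · d) = map′ (uncurry (cong₂ _·_)) (λ { refl → refl , refl }) (a ≟ᵖ c ×-dec b ≟ᵖ d)
(! a) ≟ᵖ (! b) = map′ (cong !_) (λ { refl → refl }) (a ≟ᵖ b)
pconst _ ≟ᵖ pvar _ = no λ ()
pconst _ ≟ᵖ (_ · _) = no λ ()
pconst _ ≟ᵖ (! _) = no λ ()
pvar _ ≟ᵖ pconst _ = no λ ()
pvar _ ≟ᵖ (_ · _) = no λ ()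
pvar _ ≟ᵖ (! _) = no λ ()
(_ · _) ≟ᵖ pconst _ = no λ ()
(_ · _) ≟ᵖ pvar _ = no λ ()
(_ · _) ≟ᵖ (! _) = no λ ()
(! _) ≟ᵖ pconst _ = no λ ()
(! _) ≟ᵖ pvar _ = no λ ()
(! _) ≟ᵖ (_ · _) = no λ ()

_≟ʲ_ : DecidableEquality JTerm
jvar m ≟ʲ jvar n = map′ (cong jvar) (λ { refl → refl }) (m ℕ.≟ n)
(a ⊕ b) ≟ʲ (c ⊕ d) = map′ (uncurry (cong₂ _⊕_)) (λ { refl → refl , refl }) (a ≟ʲ c ×-dec b ≟ʲ d)
jm a b ≟ʲ jm c d = map′ (uncurry (cong₂ jm)) (λ { refl → refl , refl }) (a ≟ᵖ c ×-dec b ≟ʲ d)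
jvar _ ≟ʲ (_ ⊕ _) = no λ ()
jvar _ ≟ʲ jm _ _ = no λ ()
(_ ⊕ _) ≟ʲ jvar _ = no λ ()
(_ ⊕ _) ≟ʲ jm _ _ = no λ ()
jm _ _ ≟ʲ jvar _ = no λ ()
jm _ _ ≟ʲ (_ ⊕ _) = no λ ()

_≟ᶠ_ : DecidableEquality Form
atom m ≟ᶠ atom n = map′ (cong atom) (λ { refl → refl }) (m ℕ.≟ n)
fbot ≟ᶠ fbot = yes refl
(A ⇒ B) ≟ᶠ (C ⇒ D) = map′ (uncurry (cong₂ _⇒_)) (λ { refl → refl , refl }) (A ≟ᶠ C ×-dec B ≟ᶠ D)
(a ∶ A) ≟ᶠ (b ∶ B) = map′ (uncurry (cong₂ _∶_)) (λ { refl → refl , refl }) (a ≟ᵖ b ×-dec A ≟ᶠ B)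
([ a ] A) ≟ᶠ ([ b ] B) = map′ (uncurry (cong₂ [_]_)) (λ { refl → refl , refl }) (a ≟ʲ b ×-dec A ≟ᶠ B)
atom _ ≟ᶠ fbot = no λ ()
atom _ ≟ᶠ (_ ⇒ _) = no λ ()
atom _ ≟ᶠ (_ ∶ _) = no λ ()
atom _ ≟ᶠ ([ _ ] _) = no λ ()
fbot ≟ᶠ atom _ = no λ ()
fbot ≟ᶠ (_ ⇒ _) = no λ ()
fbot ≟ᶠ (_ ∶ _) = no λ ()
fbot ≟ᶠ ([ _ ] _) = no λ ()
(_ ⇒ _) ≟ᶠ atom _ = no λ ()
(_ ⇒ _) ≟ᶠ fbot = no λ ()
(_ ⇒ _) ≟ᶠ (_ ∶ _) = no λ ()
(_ ⇒ _) ≟ᶠ ([ _ ] _) = no λ ()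
(_ ∶ _) ≟ᶠ atom _ = no λ ()
(_ ∶ _) ≟ᶠ fbot = no λ ()
(_ ∶ _) ≟ᶠ (_ ⇒ _) = no λ ()
(_ ∶ _) ≟ᶠ ([ _ ] _) = no λ ()
([ _ ] _) ≟ᶠ atom _ = no λ ()
([ _ ] _) ≟ᶠ fbot = no λ ()
([ _ ] _) ≟ᶠ (_ ⇒ _) = no λ ()
([ _ ] _) ≟ᶠ (_ ∶ _) = no λ ()

-- Propositional reasoning: a justification formula is read as a propositional formula over its
-- non-implicational subformulas.

Valuation : Set
Valuation = Form → Bool

_⊨_ : Valuation → Form → Set
v ⊨ fbot = ⊥
v ⊨ (F ⇒ G) = v ⊨ F → v ⊨ G
v ⊨ F = v F ≡ true

_⊨?_ : ∀ v F → Dec (v ⊨ F)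
v ⊨? fbot = no id
v ⊨? (F ⇒ G) = (v ⊨? F) →-dec (v ⊨? G)
v ⊨? atom P = v (atom P) Bool.≟ true
v ⊨? (l ∶ F) = v (l ∶ F) Bool.≟ true
v ⊨? ([ t ] F) = v ([ t ] F) Bool.≟ true

atoms : Form → List Form
atoms fbot = []
atoms (F ⇒ G) = atoms F ++ atoms G
atoms F = F ∷ []

position : List Form → Form → ℕ
position [] F = 0
position (G ∷ L) F with G ≟ᶠ F
... | yes _ = 0
... | no _ = suc (position L F)

lookupOr⊥ : List Form → ℕ → Form
lookupOr⊥ [] _ = fbot
lookupOr⊥ (G ∷ L) zero = G
lookupOr⊥ (G ∷ L) (suc n) = lookupOr⊥ L n

lookupOr⊥-position : ∀ L → F ∈ L → lookupOr⊥ L (position L F) ≡ F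
lookupOr⊥-position {F} (G ∷ L) F∈ with G ≟ᶠ F
... | yes G≡F = G≡F
lookupOr⊥-position (G ∷ L) (here refl) | no G≢F = ⊥-elim (G≢F refl)
lookupOr⊥-position (G ∷ L) (there F∈) | no _ = lookupOr⊥-position L F∈

skeleton : List Form → Form → PForm
skeleton L fbot = pbot
skeleton L (F ⇒ G) = skeleton L F p⇒ skeleton L G
skeleton L F = pv (position L F)

substP-skeleton : ∀ L F → atoms F ⊆ L → substP (lookupOr⊥ L) (skeleton L F) ≡ F
substP-skeleton L fbot _ = refl
substP-skeleton L (F ⇒ G) ⊆L =
  cong₂ _⇒_ (substP-skeleton L F (⊆L ∘ ∈-++⁺ˡ)) (substP-skeleton L G (⊆L ∘ ∈-++⁺ʳ (atoms F)))
substP-skeleton L (atom P) ⊆L = lookupOr⊥-position L (⊆L (here refl))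
substP-skeleton L (l ∶ F) ⊆L = lookupOr⊥-position L (⊆L (here refl))
substP-skeleton L ([ t ] F) ⊆L = lookupOr⊥-position L (⊆L (here refl))

module _ (w : ℕ → Bool) (L : List Form) where

  ⊨⇒evalP-skeleton : ∀ F → (w ∘ position L) ⊨ F → evalP w (skeleton L F) ≡ true
  evalP-skeleton⇒⊨ : ∀ F → evalP w (skeleton L F) ≡ true → (w ∘ position L) ⊨ F

  ⊨⇒evalP-skeleton fbot ()
  ⊨⇒evalP-skeleton (F ⇒ G) F⇒G with evalP w (skeleton L F) in F-true
  ... | true = ⊨⇒evalP-skeleton G (F⇒G (evalP-skeleton⇒⊨ F F-true))
  ... | false = refl
  ⊨⇒evalP-skeleton (atom P) = id
  ⊨⇒evalP-skeleton (l ∶ F) = id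
  ⊨⇒evalP-skeleton ([ t ] F) = id

  evalP-skeleton⇒⊨ fbot ()
  evalP-skeleton⇒⊨ (F ⇒ G) F⇒G-true F-holds with evalP w (skeleton L F) | ⊨⇒evalP-skeleton F F-holds
  ... | true | refl = evalP-skeleton⇒⊨ G F⇒G-true
  evalP-skeleton⇒⊨ (atom P) = id
  evalP-skeleton⇒⊨ (l ∶ F) = id
  evalP-skeleton⇒⊨ ([ t ] F) = id

valid⇒⊢ : (∀ v → v ⊨ F) → JEM⊢ CS F
valid⇒⊢ {F} valid =
  ax (taut (skeleton L F) (λ w → ⊨⇒evalP-skeleton w L F (valid _)) , lookupOr⊥ L , substP-skeleton L F id)
  where L = atoms F

entailed⇒⊢ : ∀ {Hs} → All (JEM⊢ CS) Hs → (∀ v → All (v ⊨_) Hs → v ⊨ F) → JEM⊢ CS F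
entailed⇒⊢ [] entailed = valid⇒⊢ λ v → entailed v []
entailed⇒⊢ (⊢H ∷ ⊢Hs) entailed = mp (entailed⇒⊢ ⊢Hs λ v Hs-hold H-holds → entailed v (H-holds ∷ Hs-hold)) ⊢H

⊢-trans : JEM⊢ CS (F ⇒ G) → JEM⊢ CS (G ⇒ H) → JEM⊢ CS (F ⇒ H)
⊢-trans ⊢F⇒G ⊢G⇒H = entailed⇒⊢ (⊢F⇒G ∷ ⊢G⇒H ∷ []) λ { v (F⇒G ∷ G⇒H ∷ []) → G⇒H ∘ F⇒G }

⊕-introˡ : JEM⊢ CS ([ t ] F ⇒ [ t ⊕ s ] F)
⊕-introˡ = entailed⇒⊢ (ax (ax-j+ , _ , _ , _ , refl) ∷ []) λ { v (j+ ∷ []) tF → j+ λ ¬tF → ⊥-elim (¬tF tF) }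

⊕-introʳ : JEM⊢ CS ([ s ] F ⇒ [ t ⊕ s ] F)
⊕-introʳ = entailed⇒⊢ (ax (ax-j+ , _ , _ , _ , refl) ∷ []) λ { v (j+ ∷ []) sF → j+ λ _ → sF }

jm-mono : JEM⊢ CS (l ∶ (F ⇒ G)) → JEM⊢ CS ([ t ] F ⇒ [ jm l t ] G)
jm-mono = mp (ax (ax-jm , _ , _ , _ , _ , refl))

internalize : AxiomaticallyAppropriate CS → JEM⊢ CS F → Σ PTerm λ l → JEM⊢ CS (l ∶ F)
internalize appropriate (ax axiom) = let c , cs = appropriate _ axiom in pconst c , nec cs
internalize appropriate (mp ⊢F⇒G ⊢F) =
  let l , ⊢l = internalize appropriate ⊢F⇒G
      k , ⊢k = internalize appropriate ⊢F
  in l · k , mp (mp (ax (ax-j , l , k , _ , _ , refl)) ⊢l) ⊢k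
internalize appropriate (nec cs) = ! _ , mp (ax (ax-j4 , _ , _ , refl)) (nec cs)

-- Modal formulas whose boxes are marked with their polarity; a negative box carries the index
-- of the justification variable that will realize it.
data LForm : Set where
  latom : ℕ → LForm
  lbot  : LForm
  _l⇒_  : LForm → LForm → LForm
  □⁻    : ℕ → LForm → LForm
  □⁺    : LForm → LForm

private
  variable
    A B X Y : LForm
    Γ Δ Γ′ Δ′ : List LForm
    i m n P : ℕ

erase : LForm → MForm
erase (latom P) = matom P
erase lbot = mbot
erase (A l⇒ B) = erase A m⇒ erase B
erase (□⁻ _ A) = □ erase A
erase (□⁺ A) = □ erase A

Polarized : Bool → LForm → Set
Polarized p (A l⇒ B) = Polarized (not p) A × Polarized p B
Polarized false (□⁻ _ A) = Polarized false A
Polarized true (□⁻ _ _) = ⊥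
Polarized true (□⁺ A) = Polarized true A
Polarized false (□⁺ _) = ⊥
Polarized p _ = ⊤

labels : LForm → List ℕ
labels (A l⇒ B) = labels A ++ labels B
labels (□⁻ i A) = i ∷ labels A
labels (□⁺ A) = labels A
labels _ = []

negativeBoxes : LForm → List (ℕ × LForm)
negativeBoxes (A l⇒ B) = negativeBoxes A ++ negativeBoxes B
negativeBoxes (□⁻ i A) = (i , A) ∷ negativeBoxes A
negativeBoxes (□⁺ A) = negativeBoxes A
negativeBoxes _ = []

depth : LForm → ℕ
depth (A l⇒ B) = depth A ⊔ depth B
depth (□⁻ _ A) = suc (depth A)
depth (□⁺ A) = suc (depth A)
depth _ = 0

negativeCount : Bool → MForm → ℕ
negativeCount p (A m⇒ B) = negativeCount (not p) A + negativeCount p B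
negativeCount true (□ A) = negativeCount true A
negativeCount false (□ A) = suc (negativeCount false A)
negativeCount p _ = 0

annotate : (ℕ → ℕ) → Bool → MForm → LForm
annotate f p (matom P) = latom P
annotate f p mbot = lbot
annotate f p (A m⇒ B) = annotate f (not p) A l⇒ annotate (λ k → f (negativeCount (not p) A + k)) p B
annotate f true (□ A) = □⁺ (annotate f true A)
annotate f false (□ A) = □⁻ (f 0) (annotate (f ∘ suc) false A)

erase-annotate : ∀ f p A → erase (annotate f p A) ≡ A
erase-annotate f p (matom P) = refl
erase-annotate f p mbot = refl
erase-annotate f p (A m⇒ B) = cong₂ _m⇒_ (erase-annotate _ _ A) (erase-annotate _ _ B)
erase-annotate f true (□ A) = cong □_ (erase-annotate _ _ A)
erase-annotate f false (□ A) = cong □_ (erase-annotate _ _ A)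

annotate-polarized : ∀ f p A → Polarized p (annotate f p A)
annotate-polarized f p (matom P) = tt
annotate-polarized f p mbot = tt
annotate-polarized f p (A m⇒ B) = annotate-polarized _ _ A , annotate-polarized _ _ B
annotate-polarized f true (□ A) = annotate-polarized _ _ A
annotate-polarized f false (□ A) = annotate-polarized _ _ A

applyUpTo-++ : ∀ (f : ℕ → ℕ) m n → applyUpTo f m ++ applyUpTo (λ k → f (m + k)) n ≡ applyUpTo f (m + n)
applyUpTo-++ f zero n = refl
applyUpTo-++ f (suc m) n = cong (f 0 ∷_) (applyUpTo-++ (f ∘ suc) m n)

labels-annotate : ∀ f p A → labels (annotate f p A) ≡ applyUpTo f (negativeCount p A)
labels-annotate f p (matom P) = refl
labels-annotate f p mbot = refl
labels-annotate f p (A m⇒ B) =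
  trans (cong₂ _++_ (labels-annotate _ _ A) (labels-annotate _ _ B)) (applyUpTo-++ f (negativeCount (not p) A) (negativeCount p B))
labels-annotate f true (□ A) = labels-annotate _ _ A
labels-annotate f false (□ A) = cong (f 0 ∷_) (labels-annotate _ _ A)

-- GM on marked formulas, with contexts read as sets (so weakening and contraction are built
-- in) and with RM restricted to a negative box on the left and a positive box on the right.
infix 3 _⊢_

data Closes : LForm → LForm → Set
data _⊢_ : List LForm → List LForm → Set

data Closes where
  atom : Closes (latom P) (latom P)
  box  : A ∷ [] ⊢ B ∷ [] → Closes (□⁻ i A) (□⁺ B)

data _⊢_ where
  ⊥L    : lbot ∈ Γ → Γ ⊢ Δ
  close : X ∈ Γ → Y ∈ Δ → Closes X Y → Γ ⊢ Δ
  ⇒L    : (A l⇒ B) ∈ Γ → Γ ⊢ A ∷ Δ → B ∷ Γ ⊢ Δ → Γ ⊢ Δ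
  ⇒R    : (A l⇒ B) ∈ Δ → A ∷ Γ ⊢ B ∷ Δ → Γ ⊢ Δ

⊢-mono : Γ ⊢ Δ → Γ ⊆ Γ′ → Δ ⊆ Δ′ → Γ′ ⊢ Δ′
⊢-mono (⊥L ⊥∈) Γ⊆ Δ⊆ = ⊥L (Γ⊆ ⊥∈)
⊢-mono (close X∈ Y∈ closes) Γ⊆ Δ⊆ = close (Γ⊆ X∈) (Δ⊆ Y∈) closes
⊢-mono (⇒L A⇒B∈ ⊢A ⊢B) Γ⊆ Δ⊆ = ⇒L (Γ⊆ A⇒B∈) (⊢-mono ⊢A Γ⊆ (∷⁺ʳ _ Δ⊆)) (⊢-mono ⊢B (∷⁺ʳ _ Γ⊆) Δ⊆)
⊢-mono (⇒R A⇒B∈ ⊢B) Γ⊆ Δ⊆ = ⇒R (Δ⊆ A⇒B∈) (⊢-mono ⊢B (∷⁺ʳ _ Γ⊆) (∷⁺ʳ _ Δ⊆))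

GM⇒⊢ : ∀ {Γ₀ Δ₀} → GM Γ₀ Δ₀ → Γ₀ ⊆ map erase Γ → Δ₀ ⊆ map erase Δ →
  All (Polarized false) Γ → All (Polarized true) Δ → Γ ⊢ Δ
GM⇒⊢ (axP P) Γ₀⊆ Δ₀⊆ _ _ with ∈-map⁻ erase (Γ₀⊆ (here refl)) | ∈-map⁻ erase (Δ₀⊆ (here refl))
... | latom _ , X∈ , refl | latom _ , Y∈ , refl = close X∈ Y∈ atom
GM⇒⊢ ax⊥ Γ₀⊆ _ _ _ with ∈-map⁻ erase (Γ₀⊆ (here refl))
... | lbot , ⊥∈ , refl = ⊥L ⊥∈
GM⇒⊢ (perm Γ₀↭ Δ₀↭ d) Γ₀⊆ Δ₀⊆ =
  GM⇒⊢ d (Γ₀⊆ ∘ ⊆-reflexive-↭ Γ₀↭) (Δ₀⊆ ∘ ⊆-reflexive-↭ Δ₀↭)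
GM⇒⊢ (⇒⊃ d e) Γ₀⊆ Δ₀⊆ polΓ polΔ with ∈-map⁻ erase (Γ₀⊆ (here refl))
... | A l⇒ B , A⇒B∈ , refl with All.lookup polΓ A⇒B∈
... | polA , polB =
  ⇒L A⇒B∈ (GM⇒⊢ d (Γ₀⊆ ∘ there) (∷⁺ʳ _ Δ₀⊆) polΓ (polA ∷ polΔ))
          (GM⇒⊢ e (∷⁺ʳ _ (Γ₀⊆ ∘ there)) Δ₀⊆ (polB ∷ polΓ) polΔ)
GM⇒⊢ (⊃⇒ d) Γ₀⊆ Δ₀⊆ polΓ polΔ with ∈-map⁻ erase (Δ₀⊆ (here refl))
... | A l⇒ B , A⇒B∈ , refl with All.lookup polΔ A⇒B∈
... | polA , polB = ⇒R A⇒B∈ (GM⇒⊢ d (∷⁺ʳ _ Γ₀⊆) (∷⁺ʳ _ (Δ₀⊆ ∘ there)) (polA ∷ polΓ) (polB ∷ polΔ))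
GM⇒⊢ (wL d) Γ₀⊆ = GM⇒⊢ d (Γ₀⊆ ∘ there)
GM⇒⊢ (wR d) Γ₀⊆ Δ₀⊆ = GM⇒⊢ d Γ₀⊆ (Δ₀⊆ ∘ there)
GM⇒⊢ (cL d) Γ₀⊆ = GM⇒⊢ d (∈-∷⁺ʳ (Γ₀⊆ (here refl)) Γ₀⊆)
GM⇒⊢ (cR d) Γ₀⊆ Δ₀⊆ = GM⇒⊢ d Γ₀⊆ (∈-∷⁺ʳ (Δ₀⊆ (here refl)) Δ₀⊆)
GM⇒⊢ (RM d) Γ₀⊆ Δ₀⊆ polΓ polΔ with ∈-map⁻ erase (Γ₀⊆ (here refl)) | ∈-map⁻ erase (Δ₀⊆ (here refl))
... | □⁺ _ , X∈ , refl | _ = ⊥-elim (All.lookup polΓ X∈)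
... | _ | □⁻ _ _ , Y∈ , refl = ⊥-elim (All.lookup polΔ Y∈)
... | □⁻ i A , X∈ , refl | □⁺ B , Y∈ , refl =
  close X∈ Y∈ (box (GM⇒⊢ d ⊆-refl ⊆-refl (All.lookup polΓ X∈ ∷ []) (All.lookup polΔ Y∈ ∷ [])))

_≟ˡ_ : DecidableEquality LForm
latom m ≟ˡ latom n = map′ (cong latom) (λ { refl → refl }) (m ℕ.≟ n)
lbot ≟ˡ lbot = yes refl
(A l⇒ B) ≟ˡ (C l⇒ D) = map′ (uncurry (cong₂ _l⇒_)) (λ { refl → refl , refl }) (A ≟ˡ C ×-dec B ≟ˡ D)
□⁻ i A ≟ˡ □⁻ j B = map′ (uncurry (cong₂ □⁻)) (λ { refl → refl , refl }) (i ℕ.≟ j ×-dec A ≟ˡ B)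
□⁺ A ≟ˡ □⁺ B = map′ (cong □⁺) (λ { refl → refl }) (A ≟ˡ B)
latom _ ≟ˡ lbot = no λ ()
latom _ ≟ˡ (_ l⇒ _) = no λ ()
latom _ ≟ˡ □⁻ _ _ = no λ ()
latom _ ≟ˡ □⁺ _ = no λ ()
lbot ≟ˡ latom _ = no λ ()
lbot ≟ˡ (_ l⇒ _) = no λ ()
lbot ≟ˡ □⁻ _ _ = no λ ()
lbot ≟ˡ □⁺ _ = no λ ()
(_ l⇒ _) ≟ˡ latom _ = no λ ()
(_ l⇒ _) ≟ˡ lbot = no λ ()
(_ l⇒ _) ≟ˡ □⁻ _ _ = no λ ()
(_ l⇒ _) ≟ˡ □⁺ _ = no λ ()
□⁻ _ _ ≟ˡ latom _ = no λ ()
□⁻ _ _ ≟ˡ lbot = no λ ()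
□⁻ _ _ ≟ˡ (_ l⇒ _) = no λ ()
□⁻ _ _ ≟ˡ □⁺ _ = no λ ()
□⁺ _ ≟ˡ latom _ = no λ ()
□⁺ _ ≟ˡ lbot = no λ ()
□⁺ _ ≟ˡ (_ l⇒ _) = no λ ()
□⁺ _ ≟ˡ □⁻ _ _ = no λ ()

open import Data.List.Membership.DecPropositional _≟ˡ_ using (_∈?_)
open import Data.List.Membership.DecPropositional (≡-dec ℕ._≟_ _≟ˡ_) using () renaming (_∈?_ to _∈ᵇ?_)

module _ {A : Set} {P Q : A → Set} where

  any?-on : (∀ {x} → Q x → Dec (P x)) → ∀ {xs} → All Q xs → Dec (Any P xs)
  any?-on P? [] = no λ ()
  any?-on P? (qx ∷ qxs) = map′ Any.fromSum Any.toSum (P? qx ⊎-dec any?-on P? qxs)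

  all?-on : (∀ {x} → Q x → Dec (P x)) → ∀ {xs} → All Q xs → Dec (All P xs)
  all?-on P? [] = yes []
  all?-on P? (qx ∷ qxs) = map′ (uncurry _∷_) All.uncons (P? qx ×-dec all?-on P? qxs)

Assignment : Set
Assignment = List LForm × List LForm

trues falses : Assignment → List LForm
trues = proj₁
falses = proj₂

private
  variable
    a b : Assignment

_∪_ : Assignment → Assignment → Assignment
a ∪ b = trues a ++ trues b , falses a ++ falses b

_⊑_ : Assignment → Assignment → Set
a ⊑ b = trues a ⊆ trues b × falses a ⊆ falses b

∪-upperˡ : a ⊑ (a ∪ b)
∪-upperˡ {a} {b} = xs⊆xs++ys (trues a) (trues b) , xs⊆xs++ys (falses a) (falses b)

∪-upperʳ : b ⊑ (a ∪ b)
∪-upperʳ {b} {a} = xs⊆ys++xs (trues b) (trues a) , xs⊆ys++xs (falses b) (falses a)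

Verifies : Assignment → LForm → Set
Falsifies : Assignment → LForm → Set
Verifies a (A l⇒ B) = Falsifies a A ⊎ Verifies a B
Verifies a X = X ∈ trues a
Falsifies a (A l⇒ B) = Verifies a A × Falsifies a B
Falsifies a X = X ∈ falses a

verifies-mono : a ⊑ b → ∀ A → Verifies a A → Verifies b A
falsifies-mono : a ⊑ b → ∀ A → Falsifies a A → Falsifies b A
verifies-mono a⊑b (A l⇒ B) (inj₁ fA) = inj₁ (falsifies-mono a⊑b A fA)
verifies-mono a⊑b (A l⇒ B) (inj₂ vB) = inj₂ (verifies-mono a⊑b B vB)
verifies-mono a⊑b (latom _) = proj₁ a⊑b
verifies-mono a⊑b lbot = proj₁ a⊑b
verifies-mono a⊑b (□⁻ _ _) = proj₁ a⊑b
verifies-mono a⊑b (□⁺ _) = proj₁ a⊑b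
falsifies-mono a⊑b (A l⇒ B) (vA , fB) = verifies-mono a⊑b A vA , falsifies-mono a⊑b B fB
falsifies-mono a⊑b (latom _) = proj₂ a⊑b
falsifies-mono a⊑b lbot = proj₂ a⊑b
falsifies-mono a⊑b (□⁻ _ _) = proj₂ a⊑b
falsifies-mono a⊑b (□⁺ _) = proj₂ a⊑b

verifiers : LForm → List Assignment
falsifiers : LForm → List Assignment
verifiers (A l⇒ B) = falsifiers A ++ verifiers B
verifiers X = (X ∷ [] , []) ∷ []
falsifiers (A l⇒ B) = cartesianProductWith _∪_ (verifiers A) (falsifiers B)
falsifiers X = ([] , X ∷ []) ∷ []

refuters : List LForm → List LForm → List Assignment
refuters [] [] = ([] , []) ∷ []
refuters (A ∷ Γ) Δ = cartesianProductWith _∪_ (verifiers A) (refuters Γ Δ)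
refuters [] (B ∷ Δ) = cartesianProductWith _∪_ (falsifiers B) (refuters [] Δ)

Refutes : Assignment → List LForm → List LForm → Set
Refutes a Γ Δ = All (Verifies a) Γ × All (Falsifies a) Δ

∈-verifiers⇒verifies : ∀ A → a ∈ verifiers A → Verifies a A
∈-falsifiers⇒falsifies : ∀ A → a ∈ falsifiers A → Falsifies a A
∈-verifiers⇒verifies (A l⇒ B) a∈ with ∈-++⁻ (falsifiers A) a∈
... | inj₁ a∈A = inj₁ (∈-falsifiers⇒falsifies A a∈A)
... | inj₂ a∈B = inj₂ (∈-verifiers⇒verifies B a∈B)
∈-verifiers⇒verifies (latom _) (here refl) = here refl
∈-verifiers⇒verifies lbot (here refl) = here refl
∈-verifiers⇒verifies (□⁻ _ _) (here refl) = here refl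
∈-verifiers⇒verifies (□⁺ _) (here refl) = here refl
∈-falsifiers⇒falsifies (A l⇒ B) a∈ with ∈-cartesianProductWith⁻ _∪_ (verifiers A) (falsifiers B) a∈
... | b , c , b∈ , c∈ , refl =
  verifies-mono ∪-upperˡ A (∈-verifiers⇒verifies A b∈) , falsifies-mono ∪-upperʳ B (∈-falsifiers⇒falsifies B c∈)
∈-falsifiers⇒falsifies (latom _) (here refl) = here refl
∈-falsifiers⇒falsifies lbot (here refl) = here refl
∈-falsifiers⇒falsifies (□⁻ _ _) (here refl) = here refl
∈-falsifiers⇒falsifies (□⁺ _) (here refl) = here refl

∈-refuters⇒refutes : ∀ Γ Δ → a ∈ refuters Γ Δ → Refutes a Γ Δ
∈-refuters⇒refutes [] [] _ = [] , []
∈-refuters⇒refutes (A ∷ Γ) Δ a∈ with ∈-cartesianProductWith⁻ _∪_ (verifiers A) (refuters Γ Δ) a∈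
... | b , c , b∈ , c∈ , refl =
  let vΓ , fΔ = ∈-refuters⇒refutes Γ Δ c∈
  in verifies-mono ∪-upperˡ A (∈-verifiers⇒verifies A b∈) ∷ All.map (verifies-mono ∪-upperʳ _) vΓ
   , All.map (falsifies-mono ∪-upperʳ _) fΔ
∈-refuters⇒refutes [] (B ∷ Δ) a∈ with ∈-cartesianProductWith⁻ _∪_ (falsifiers B) (refuters [] Δ) a∈
... | b , c , b∈ , c∈ , refl =
  [] , falsifies-mono ∪-upperˡ B (∈-falsifiers⇒falsifies B b∈) ∷ All.map (falsifies-mono ∪-upperʳ _) (proj₂ (∈-refuters⇒refutes [] Δ c∈))

Axiomatic : List LForm → List LForm → Set
Axiomatic Γ Δ = lbot ∈ Γ ⊎ Any (λ X → Any (Closes X) Δ) Γ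

axiomatic⇒⊢ : Axiomatic Γ Δ → Γ ⊢ Δ
axiomatic⇒⊢ (inj₁ ⊥∈) = ⊥L ⊥∈
axiomatic⇒⊢ (inj₂ closing) =
  let X , X∈ , closingX = find closing
      Y , Y∈ , closes = find closingX
  in close X∈ Y∈ closes

⊢⇒axiomatic : Γ ⊢ Δ → Refutes a Γ Δ → Axiomatic (trues a) (falses a)
⊢⇒axiomatic (⊥L ⊥∈) (vΓ , _) = inj₁ (All.lookup vΓ ⊥∈)
⊢⇒axiomatic (close X∈ Y∈ atom) (vΓ , fΔ) = inj₂ (lose (All.lookup vΓ X∈) (lose (All.lookup fΔ Y∈) atom))
⊢⇒axiomatic (close X∈ Y∈ (box ⊢AB)) (vΓ , fΔ) =
  inj₂ (lose (All.lookup vΓ X∈) (lose (All.lookup fΔ Y∈) (box ⊢AB)))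
⊢⇒axiomatic (⇒L A⇒B∈ ⊢A ⊢B) (vΓ , fΔ) with All.lookup vΓ A⇒B∈
... | inj₁ fA = ⊢⇒axiomatic ⊢A (vΓ , fA ∷ fΔ)
... | inj₂ vB = ⊢⇒axiomatic ⊢B (vB ∷ vΓ , fΔ)
⊢⇒axiomatic (⇒R A⇒B∈ ⊢B) (vΓ , fΔ) with All.lookup fΔ A⇒B∈
... | vA , fB = ⊢⇒axiomatic ⊢B (vA ∷ vΓ , fB ∷ fΔ)

++-swap-⊆ : ∀ {zs zs′ : List LForm} xs ys → zs ⊆ zs′ → (xs ++ ys) ++ zs ⊆ ys ++ xs ++ zs′
++-swap-⊆ xs ys zs⊆ =
  ⊆-trans (⊆-reflexive-↭ (↭-trans (++-assoc xs ys _) (shifts xs ys))) (++⁺ʳ ys (++⁺ʳ xs zs⊆))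

⊢-by-verifiers : ∀ A → A ∈ Γ → (∀ {a} → a ∈ verifiers A → trues a ++ Γ ⊢ falses a ++ Δ) → Γ ⊢ Δ
⊢-by-falsifiers : ∀ B → B ∈ Δ → (∀ {a} → a ∈ falsifiers B → trues a ++ Γ ⊢ falses a ++ Δ) → Γ ⊢ Δ
⊢-by-verifiers (A l⇒ B) A⇒B∈ ⊢each = ⇒L A⇒B∈
  (⊢-by-falsifiers A (here refl) λ {a} a∈ →
     ⊢-mono (⊢each (∈-++⁺ˡ a∈)) ⊆-refl (++⁺ʳ (falses a) (xs⊆x∷xs _ A)))
  (⊢-by-verifiers B (here refl) λ {a} a∈ →
     ⊢-mono (⊢each (∈-++⁺ʳ (falsifiers A) a∈)) (++⁺ʳ (trues a) (xs⊆x∷xs _ B)) ⊆-refl)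
⊢-by-verifiers (latom _) X∈ ⊢each = ⊢-mono (⊢each (here refl)) (∈-∷⁺ʳ X∈ ⊆-refl) ⊆-refl
⊢-by-verifiers lbot X∈ ⊢each = ⊢-mono (⊢each (here refl)) (∈-∷⁺ʳ X∈ ⊆-refl) ⊆-refl
⊢-by-verifiers (□⁻ _ _) X∈ ⊢each = ⊢-mono (⊢each (here refl)) (∈-∷⁺ʳ X∈ ⊆-refl) ⊆-refl
⊢-by-verifiers (□⁺ _) X∈ ⊢each = ⊢-mono (⊢each (here refl)) (∈-∷⁺ʳ X∈ ⊆-refl) ⊆-refl
⊢-by-falsifiers (A l⇒ B) A⇒B∈ ⊢each = ⇒R A⇒B∈
  (⊢-by-verifiers A (here refl) λ {a} a∈ →
     ⊢-by-falsifiers B (∈-++⁺ʳ (falses a) (here refl)) λ {b} b∈ →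
       ⊢-mono (⊢each (∈-cartesianProductWith⁺ _∪_ a∈ b∈))
              (++-swap-⊆ (trues a) (trues b) (xs⊆x∷xs _ A)) (++-swap-⊆ (falses a) (falses b) (xs⊆x∷xs _ B)))
⊢-by-falsifiers (latom _) X∈ ⊢each = ⊢-mono (⊢each (here refl)) ⊆-refl (∈-∷⁺ʳ X∈ ⊆-refl)
⊢-by-falsifiers lbot X∈ ⊢each = ⊢-mono (⊢each (here refl)) ⊆-refl (∈-∷⁺ʳ X∈ ⊆-refl)
⊢-by-falsifiers (□⁻ _ _) X∈ ⊢each = ⊢-mono (⊢each (here refl)) ⊆-refl (∈-∷⁺ʳ X∈ ⊆-refl)
⊢-by-falsifiers (□⁺ _) X∈ ⊢each = ⊢-mono (⊢each (here refl)) ⊆-refl (∈-∷⁺ʳ X∈ ⊆-refl)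

⊢-by-refuters : ∀ Γ₀ Δ₀ → Γ₀ ⊆ Γ → Δ₀ ⊆ Δ →
  (∀ {a} → a ∈ refuters Γ₀ Δ₀ → trues a ++ Γ ⊢ falses a ++ Δ) → Γ ⊢ Δ
⊢-by-refuters [] [] _ _ ⊢each = ⊢each (here refl)
⊢-by-refuters (A ∷ Γ₀) Δ₀ Γ₀⊆ Δ₀⊆ ⊢each = ⊢-by-verifiers A (Γ₀⊆ (here refl)) λ {a} a∈ →
  ⊢-by-refuters Γ₀ Δ₀ (xs⊆ys++xs _ (trues a) ∘ Γ₀⊆ ∘ there) (xs⊆ys++xs _ (falses a) ∘ Δ₀⊆) λ {b} b∈ →
    ⊢-mono (⊢each (∈-cartesianProductWith⁺ _∪_ a∈ b∈))
           (++-swap-⊆ (trues a) (trues b) ⊆-refl) (++-swap-⊆ (falses a) (falses b) ⊆-refl)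
⊢-by-refuters [] (B ∷ Δ₀) _ Δ₀⊆ ⊢each = ⊢-by-falsifiers B (Δ₀⊆ (here refl)) λ {a} a∈ →
  ⊢-by-refuters [] Δ₀ (λ ()) (xs⊆ys++xs _ (falses a) ∘ Δ₀⊆ ∘ there) λ {b} b∈ →
    ⊢-mono (⊢each (∈-cartesianProductWith⁺ _∪_ a∈ b∈))
           (++-swap-⊆ (trues a) (trues b) ⊆-refl) (++-swap-⊆ (falses a) (falses b) ⊆-refl)

Closed : List LForm → List LForm → Set
Closed Γ Δ = All (λ a → Axiomatic (trues a) (falses a)) (refuters Γ Δ)

closed⇒⊢ : Closed Γ Δ → Γ ⊢ Δ
closed⇒⊢ {Γ} {Δ} closed = ⊢-by-refuters Γ Δ ⊆-refl ⊆-refl λ {a} a∈ →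
  ⊢-mono (axiomatic⇒⊢ (All.lookup closed a∈)) (xs⊆xs++ys _ Γ) (xs⊆xs++ys _ Δ)

⊢⇒closed : Γ ⊢ Δ → Closed Γ Δ
⊢⇒closed {Γ} {Δ} ⊢ΓΔ = All.tabulate λ a∈ → ⊢⇒axiomatic ⊢ΓΔ (∈-refuters⇒refutes Γ Δ a∈)

Below : ℕ → LForm → Set
Below n A = depth A ≤ n

Bounded : ℕ → Assignment → Set
Bounded n a = All (Below n) (trues a) × All (Below n) (falses a)

∪-bounded : Bounded n a → Bounded n b → Bounded n (a ∪ b)
∪-bounded (Ta , Fa) (Tb , Fb) = All.++⁺ Ta Tb , All.++⁺ Fa Fb

∈-verifiers⇒bounded : ∀ A → Below n A → a ∈ verifiers A → Bounded n a
∈-falsifiers⇒bounded : ∀ A → Below n A → a ∈ falsifiers A → Bounded n a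
∈-verifiers⇒bounded (A l⇒ B) A⇒B≤ a∈ with ∈-++⁻ (falsifiers A) a∈
... | inj₁ a∈A = ∈-falsifiers⇒bounded A (m⊔n≤o⇒m≤o _ _ A⇒B≤) a∈A
... | inj₂ a∈B = ∈-verifiers⇒bounded B (m⊔n≤o⇒n≤o _ _ A⇒B≤) a∈B
∈-verifiers⇒bounded (latom _) X≤ (here refl) = X≤ ∷ [] , []
∈-verifiers⇒bounded lbot X≤ (here refl) = X≤ ∷ [] , []
∈-verifiers⇒bounded (□⁻ _ _) X≤ (here refl) = X≤ ∷ [] , []
∈-verifiers⇒bounded (□⁺ _) X≤ (here refl) = X≤ ∷ [] , []
∈-falsifiers⇒bounded (A l⇒ B) A⇒B≤ a∈ with ∈-cartesianProductWith⁻ _∪_ (verifiers A) (falsifiers B) a∈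
... | b , c , b∈ , c∈ , refl =
  ∪-bounded (∈-verifiers⇒bounded A (m⊔n≤o⇒m≤o _ _ A⇒B≤) b∈) (∈-falsifiers⇒bounded B (m⊔n≤o⇒n≤o _ _ A⇒B≤) c∈)
∈-falsifiers⇒bounded (latom _) X≤ (here refl) = [] , X≤ ∷ []
∈-falsifiers⇒bounded lbot X≤ (here refl) = [] , X≤ ∷ []
∈-falsifiers⇒bounded (□⁻ _ _) X≤ (here refl) = [] , X≤ ∷ []
∈-falsifiers⇒bounded (□⁺ _) X≤ (here refl) = [] , X≤ ∷ []

∈-refuters⇒bounded : All (Below n) Γ → All (Below n) Δ → a ∈ refuters Γ Δ → Bounded n a
∈-refuters⇒bounded [] [] (here refl) = [] , []
∈-refuters⇒bounded {Γ = A ∷ Γ} {Δ} (A≤ ∷ Γ≤) Δ≤ a∈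
  with ∈-cartesianProductWith⁻ _∪_ (verifiers A) (refuters Γ Δ) a∈
... | b , c , b∈ , c∈ , refl = ∪-bounded (∈-verifiers⇒bounded A A≤ b∈) (∈-refuters⇒bounded Γ≤ Δ≤ c∈)
∈-refuters⇒bounded {Γ = []} {B ∷ Δ} [] (B≤ ∷ Δ≤) a∈
  with ∈-cartesianProductWith⁻ _∪_ (falsifiers B) (refuters [] Δ) a∈
... | b , c , b∈ , c∈ , refl = ∪-bounded (∈-falsifiers⇒bounded B B≤ b∈) (∈-refuters⇒bounded [] Δ≤ c∈)

closes? : ∀ n X Y → Below n X → Below n Y → Dec (Closes X Y)
⊢? : ∀ n → All (Below n) Γ → All (Below n) Δ → Dec (Γ ⊢ Δ)

closes? n (latom P) (latom Q) _ _ = map′ (λ { refl → atom }) (λ { atom → refl }) (P ℕ.≟ Q)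
closes? zero (□⁻ i A) (□⁺ B) () _
closes? (suc n) (□⁻ i A) (□⁺ B) A≤ B≤ =
  map′ box (λ { (box ⊢AB) → ⊢AB }) (⊢? n (s≤s⁻¹ A≤ ∷ []) (s≤s⁻¹ B≤ ∷ []))
closes? n (latom _) lbot _ _ = no λ ()
closes? n (latom _) (_ l⇒ _) _ _ = no λ ()
closes? n (latom _) (□⁻ _ _) _ _ = no λ ()
closes? n (latom _) (□⁺ _) _ _ = no λ ()
closes? n (□⁻ _ _) (latom _) _ _ = no λ ()
closes? n (□⁻ _ _) lbot _ _ = no λ ()
closes? n (□⁻ _ _) (_ l⇒ _) _ _ = no λ ()
closes? n (□⁻ _ _) (□⁻ _ _) _ _ = no λ ()
closes? n lbot _ _ _ = no λ ()
closes? n (_ l⇒ _) _ _ _ = no λ ()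
closes? n (□⁺ _) _ _ _ = no λ ()

⊢? {Γ} {Δ} n Γ≤ Δ≤ = map′ closed⇒⊢ ⊢⇒closed (all?-on axiomatic? (All.tabulate (∈-refuters⇒bounded Γ≤ Δ≤)))
  where
  axiomatic? : ∀ {a} → Bounded n a → Dec (Axiomatic (trues a) (falses a))
  axiomatic? {a} (T≤ , F≤) =
    lbot ∈? trues a ⊎-dec any?-on (λ {X} X≤ → any?-on (λ {Y} Y≤ → closes? n X Y X≤ Y≤) F≤) T≤

⊢?-single : ∀ A B → Dec (A ∷ [] ⊢ B ∷ [])
⊢?-single A B = ⊢? (depth A ⊔ depth B) (m≤m⊔n _ _ ∷ []) (m≤n⊔m _ _ ∷ [])

record Realizes (CS : ConstSpec) (r : LForm → Form) (Γ Δ : List LForm) : Set where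
  constructor realizes
  field
    lemmas : List Form
    lemmas-provable : All (JEM⊢ CS) lemmas
    sound : ∀ v → All (v ⊨_) lemmas → All (λ A → v ⊨ r A) Γ → Any (λ B → v ⊨ r B) Δ

module _ {r : LForm → Form} where

  realizes⇒⊢ : Realizes CS r [] (A ∷ []) → JEM⊢ CS (r A)
  realizes⇒⊢ (realizes _ provable sound) = entailed⇒⊢ provable λ v lemmas-hold → singleton⁻ (sound v lemmas-hold [])

  realizes⇒⊢⇒ : Realizes CS r (A ∷ []) (B ∷ []) → JEM⊢ CS (r A ⇒ r B)
  realizes⇒⊢⇒ (realizes _ provable sound) =
    entailed⇒⊢ provable λ v lemmas-hold rA → singleton⁻ (sound v lemmas-hold (rA ∷ []))

  ⇒L-realizes : r (A l⇒ B) ≡ (r A ⇒ r B) → (A l⇒ B) ∈ Γ →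
    Realizes CS r Γ (A ∷ Δ) → Realizes CS r (B ∷ Γ) Δ → Realizes CS r Γ Δ
  ⇒L-realizes {A = A} {Γ = Γ} {Δ = Δ} r-⇒ A⇒B∈ (realizes Hs ⊢Hs soundA) (realizes Ks ⊢Ks soundB) =
    realizes (Hs ++ Ks) (All.++⁺ ⊢Hs ⊢Ks) sound
    where
    sound : ∀ v → All (v ⊨_) (Hs ++ Ks) → All (λ C → v ⊨ r C) Γ → Any (λ C → v ⊨ r C) Δ
    sound v HsKs rΓ with All.++⁻ Hs HsKs | v ⊨? r A
    ... | _ , Ks-hold | yes rA = soundB v Ks-hold (subst (v ⊨_) r-⇒ (All.lookup rΓ A⇒B∈) rA ∷ rΓ)
    ... | Hs-hold , _ | no ¬rA with soundA v Hs-hold rΓ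
    ...   | here rA = ⊥-elim (¬rA rA)
    ...   | there rΔ = rΔ

  ⇒R-realizes : r (A l⇒ B) ≡ (r A ⇒ r B) → (A l⇒ B) ∈ Δ → Realizes CS r (A ∷ Γ) (B ∷ Δ) → Realizes CS r Γ Δ
  ⇒R-realizes {A = A} {Δ = Δ} {Γ = Γ} r-⇒ A⇒B∈ (realizes Hs ⊢Hs soundB) = realizes Hs ⊢Hs sound
    where
    sound : ∀ v → All (v ⊨_) Hs → All (λ C → v ⊨ r C) Γ → Any (λ C → v ⊨ r C) Δ
    sound v Hs-hold rΓ with v ⊨? r A
    ... | no ¬rA = lose A⇒B∈ (subst (v ⊨_) (sym r-⇒) (⊥-elim ∘ ¬rA))
    ... | yes rA with soundB v Hs-hold (rA ∷ rΓ)
    ...   | here rB = lose A⇒B∈ (subst (v ⊨_) (sym r-⇒) λ _ → rB)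
    ...   | there rΔ = rΔ

module Realization {CS : ConstSpec} (appropriate : AxiomaticallyAppropriate CS) (boxes : List (ℕ × LForm)) where

  Admissible : ℕ → LForm → Set
  Admissible m (A l⇒ B) = Admissible m A × Admissible m B
  Admissible zero (□⁻ _ _) = ⊥
  Admissible zero (□⁺ _) = ⊥
  Admissible (suc m) (□⁻ i A) = (i , A) ∈ boxes × Admissible m A
  Admissible (suc m) (□⁺ B) = Admissible m B
  Admissible m _ = ⊤

  admissible? : ∀ m A → Dec (Admissible m A)
  admissible? m (A l⇒ B) = admissible? m A ×-dec admissible? m B
  admissible? zero (□⁻ _ _) = no id
  admissible? zero (□⁺ _) = no id
  admissible? (suc m) (□⁻ i A) = (i , A) ∈ᵇ? boxes ×-dec admissible? m A
  admissible? (suc m) (□⁺ B) = admissible? m B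
  admissible? m (latom _) = yes tt
  admissible? m lbot = yes tt

  Step : ℕ → LForm → LForm → Set
  Step m A B = Admissible m A × Admissible m B × A ∷ [] ⊢ B ∷ []

  step? : ∀ m A B → Dec (Step m A B)
  step? m A B = admissible? m A ×-dec admissible? m B ×-dec ⊢?-single A B

  ∑ : List JTerm → JTerm
  ∑ [] = jvar 0
  ∑ (t ∷ ts) = t ⊕ ∑ ts

  -- Admissible formulas of level 0 have no boxes; the box clauses at level 0 are junk.
  realize : ℕ → LForm → Form
  witnesses : ℕ → LForm → List (ℕ × LForm) → List JTerm
  realize-mono : ∀ m {A B} → Step m A B → JEM⊢ CS (realize m A ⇒ realize m B)
  realize-sound : ∀ m → Γ ⊢ Δ → All (Admissible m) Γ → All (Admissible m) Δ → Realizes CS (realize m) Γ Δ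
  box-realized : ∀ m {A B} L → (i , A) ∈ L → Step m A B →
    JEM⊢ CS ([ jvar i ] realize m A ⇒ [ ∑ (witnesses m B L) ] realize m B)

  realize m (latom P) = atom P
  realize m lbot = fbot
  realize m (A l⇒ B) = realize m A ⇒ realize m B
  realize zero (□⁻ i A) = [ jvar i ] realize zero A
  realize zero (□⁺ B) = [ jvar 0 ] realize zero B
  realize (suc m) (□⁻ i A) = [ jvar i ] realize m A
  realize (suc m) (□⁺ B) = [ ∑ (witnesses m B boxes) ] realize m B

  witnesses m B [] = []
  witnesses m B ((i , A) ∷ L) with step? m A B
  ... | yes A⊢B = jm (proj₁ (internalize appropriate (realize-mono m A⊢B))) (jvar i) ∷ witnesses m B L
  ... | no _ = witnesses m B L

  realize-mono m (A-adm , B-adm , ⊢AB) = realizes⇒⊢⇒ (realize-sound m ⊢AB (A-adm ∷ []) (B-adm ∷ []))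

  box-realized m {A} {B} ((i , A) ∷ L) (here refl) A⊢B with step? m A B
  ... | yes A⊢B′ = ⊢-trans (jm-mono (proj₂ (internalize appropriate (realize-mono m A⊢B′)))) ⊕-introˡ
  ... | no ¬A⊢B = ⊥-elim (¬A⊢B A⊢B)
  box-realized m {B = B} ((j , A′) ∷ L) (there iA∈) A⊢B with step? m A′ B
  ... | yes _ = ⊢-trans (box-realized m L iA∈ A⊢B) ⊕-introʳ
  ... | no _ = box-realized m L iA∈ A⊢B


  realize-sound m (⊥L ⊥∈) _ _ = realizes [] [] λ v _ rΓ → ⊥-elim (All.lookup rΓ ⊥∈)
  realize-sound m (close X∈ Y∈ atom) _ _ = realizes [] [] λ v _ rΓ → lose Y∈ (All.lookup rΓ X∈)
  realize-sound zero (close X∈ _ (box _)) admΓ _ = ⊥-elim (All.lookup admΓ X∈)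
  realize-sound (suc m) (close X∈ Y∈ (box ⊢AB)) admΓ admΔ =
    let iA∈ , A-adm = All.lookup admΓ X∈
    in realizes (_ ∷ []) (box-realized m boxes iA∈ (A-adm , All.lookup admΔ Y∈ , ⊢AB) ∷ [])
         λ v box-step rΓ → lose Y∈ (All.head box-step (All.lookup rΓ X∈))
  realize-sound m (⇒L A⇒B∈ ⊢A ⊢B) admΓ admΔ =
    let A-adm , B-adm = All.lookup admΓ A⇒B∈
    in ⇒L-realizes refl A⇒B∈ (realize-sound m ⊢A admΓ (A-adm ∷ admΔ)) (realize-sound m ⊢B (B-adm ∷ admΓ) admΔ)
  realize-sound m (⇒R A⇒B∈ ⊢B) admΓ admΔ =
    let A-adm , B-adm = All.lookup admΔ A⇒B∈
    in ⇒R-realizes refl A⇒B∈ (realize-sound m ⊢B (A-adm ∷ admΓ) (B-adm ∷ admΔ))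

  realize-forgets : ∀ n A → Forget (realize n A) (erase A)
  realize-forgets n (latom P) = f-atom P
  realize-forgets n lbot = f-bot
  realize-forgets n (A l⇒ B) = f-imp (realize-forgets n A) (realize-forgets n B)
  realize-forgets zero (□⁻ i A) = f-box (realize-forgets zero A)
  realize-forgets zero (□⁺ A) = f-box (realize-forgets zero A)
  realize-forgets (suc n) (□⁻ i A) = f-box (realize-forgets n A)
  realize-forgets (suc n) (□⁺ A) = f-box (realize-forgets n A)

  negTerms-realize : ∀ n p A → Polarized p A → negTerms p (realize n A) ≡ map jvar (labels A)
  negTerms-realize n p (latom P) _ = refl
  negTerms-realize n p lbot _ = refl
  negTerms-realize n p (A l⇒ B) (polA , polB) =
    trans (cong₂ _++_ (negTerms-realize n (not p) A polA) (negTerms-realize n p B polB))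
          (sym (map-++ jvar (labels A) (labels B)))
  negTerms-realize zero false (□⁻ i A) polA = cong (jvar i ∷_) (negTerms-realize zero false A polA)
  negTerms-realize zero true (□⁺ A) polA = negTerms-realize zero true A polA
  negTerms-realize (suc n) false (□⁻ i A) polA = cong (jvar i ∷_) (negTerms-realize n false A polA)
  negTerms-realize (suc n) true (□⁺ A) polA = negTerms-realize n true A polA

  admissible : ∀ n A → depth A ≤ n → negativeBoxes A ⊆ boxes → Admissible n A
  admissible n (latom _) _ _ = tt
  admissible n lbot _ _ = tt
  admissible n (A l⇒ B) A⇒B≤ ⊆boxes =
    admissible n A (m⊔n≤o⇒m≤o _ _ A⇒B≤) (⊆boxes ∘ ∈-++⁺ˡ) ,
    admissible n B (m⊔n≤o⇒n≤o _ _ A⇒B≤) (⊆boxes ∘ ∈-++⁺ʳ (negativeBoxes A))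
  admissible (suc n) (□⁻ i A) A≤ ⊆boxes = ⊆boxes (here refl) , admissible n A (s≤s⁻¹ A≤) (⊆boxes ∘ there)
  admissible (suc n) (□⁺ A) A≤ ⊆boxes = admissible n A (s≤s⁻¹ A≤) ⊆boxes

marked : MForm → LForm
marked = annotate id true

module _ {CS : ConstSpec} (appropriate : AxiomaticallyAppropriate CS) (A : MForm) where

  private
    A′ = marked A
  open Realization appropriate (negativeBoxes A′)

  realization : Form
  realization = realize (depth A′) A′

  realization-forgets : Forget realization A
  realization-forgets = subst (Forget realization) (erase-annotate id true A) (realize-forgets (depth A′) A′)

  negTerms-realization : negTerms true realization ≡ map jvar (upTo (negativeCount true A))
  negTerms-realization = trans (negTerms-realize (depth A′) true A′ (annotate-polarized id true A))
                               (cong (map jvar) (labels-annotate id true A))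

  realization-sound : GM [] (A ∷ []) → JEM⊢ CS realization
  realization-sound ⊢A = realizes⇒⊢ (realize-sound (depth A′) ⊢A′ [] (A′-admissible ∷ []))
    where
    ⊢A′ : [] ⊢ A′ ∷ []
    ⊢A′ = GM⇒⊢ ⊢A (λ ()) (λ { (here refl) → here (sym (erase-annotate id true A)) }) []
                  (annotate-polarized id true A ∷ [])
    A′-admissible : Admissible (depth A′) A′
    A′-admissible = admissible (depth A′) A′ ≤-refl ⊆-refl

mainTheorem8 : (CS : ConstSpec) → IsConstSpec CS → AxiomaticallyAppropriate CS → Schematic CS →
    Σ (MForm → Form) λ r → Realization r × Normal r ×
    (∀ A → GM [] (A ∷ []) → JEM⊢ CS (r A))
mainTheorem8 CS _ appropriate _ =
  realization appropriate ,
  realization-forgets appropriate ,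
  (λ A → upTo (negativeCount true A) , sym (negTerms-realization appropriate A) , upTo⁺ _) ,
  realization-sound appropriate
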